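{- Let $n$ be a non-negative integer. For $k\in\{1,\dots,\lfloor\frac n2\rfloor\}$ let $$\nabla_k=\nabla B^{n-2k}_{n,-k}=\left(\binom{ -k+j-i}{n-2k+1-i}\bmod 2\right)_{1\le i\le j\le n}.$$ When $n$ is odd, let $\nabla_{(n+1)/2}=\nabla(1)_n$. Then $\{\nabla_1,\dots,\nabla_{\lceil n/2\rceil}\}$ is a basis of $\mathcal{HST}(n)$.
   Context: Binomial coefficients $\binom{a}{b}$ are defined for all integers $a,b$ by $\binom{a}{0}=1$, $\binom{0}{b}=0$ for $b>0$, and $\binom{a}{b}=\binom{a-1}{b-1}+\binom{a-1}{b}$ for all $a,b\in\mathbb{Z}$. A binary Steinhaus triangle of size $n$ is an array $(a_{i,j})_{1\le i\le j\le n}$ of elements of $\{0,1\}$ with $a_{i,j}\equiv a_{i-1,j-1}+a_{i-1,j}\pmod 2$ for $2\le i\le j\le n$. $\nabla S$ is the triangle with first row $S$, and these triangles form a vector space over $\mathbb{Z}/2\mathbb{Z}$. The horizontal reflection is $h((a_{i,j}))=(a_{i,n-j+i})_{1\le i\le j\le n}$, and $\mathcal{HST}(n)=\{\nabla: h(\nabla)=\nabla\}$. $B^{k}_{n,l}=\left(\binom{l+j-1}{k}\bmod 2\right)_{1\le j\le n}$, and $(1)_n$ is the all-ones sequence of length $n$. -}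

module Defs where

open import Data.Nat using (ℕ; zero; suc; _∸_; _≤_; _≡ᵇ_; _%_; ⌈_/2⌉) renaming (_+_ to _+ℕ_; _*_ to _*ℕ_)
open import Data.Integer using (ℤ; +_; -[1+_]; _+_; _-_; -_; ∣_∣)
open import Data.Bool using (Bool; true; false; _xor_; _∧_; if_then_else_)
open import Data.Fin using (Fin; toℕ)
open import Relation.Binary.PropositionalEquality using (_≡_)

-- Binomial coefficients binom a b for a ∈ ℤ and b ∈ ℕ, following exactly the
-- recursion of the paper: binom a 0 = 1, binom 0 b = 0 (b > 0),
-- binom a b = binom (a-1) (b-1) + binom (a-1) b.
-- For a = -m < 0 this recursion is solved as
-- binom (-m) (b+1) = binom (-m+1) (b+1) - binom (-m) b.
-- (Only b ≥ 0 is needed in the statement.)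
-- posBinom a b = binom (+ a) b
posBinom : ℕ → ℕ → ℤ
posBinom a zero = + 1
posBinom zero (suc b) = + 0
posBinom (suc a) (suc b) = posBinom a b + posBinom a (suc b)

negBinom : ℕ → ℕ → ℤ
negBinom zero b = posBinom zero b
negBinom (suc m) zero = + 1
negBinom (suc m) (suc b) = negBinom m (suc b) - negBinom (suc m) b

binom : ℤ → ℕ → ℤ
binom (+ a) b = posBinom a b
binom -[1+ m ] b = negBinom (suc m) b

mod2 : ℤ → Bool
mod2 x = (∣ x ∣ % 2) ≡ᵇ 1

-- Sequences (first rows) are ℕ → Bool, only indices 1..n are relevant.
Seq : Set
Seq = ℕ → Bool

-- Arrays a i j; only entries with 1 ≤ i ≤ j ≤ n are relevant.
Array : Set
Array = ℕ → ℕ → Bool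

_≈[_]_ : Array → ℕ → Array → Set
a ≈[ n ] b = ∀ i j → 1 ≤ i → i ≤ j → j ≤ n → a i j ≡ b i j

IsSteinhaus : ℕ → Array → Set
IsSteinhaus n a = ∀ i j → 2 ≤ i → i ≤ j → j ≤ n →
  a i j ≡ (a (i ∸ 1) (j ∸ 1) xor a (i ∸ 1) j)

nabla : Seq → Array
nabla S zero j = S j
nabla S (suc zero) j = S j
nabla S (suc (suc i)) j = nabla S (suc i) (j ∸ 1) xor nabla S (suc i) j

hrefl : ℕ → Array → Array
hrefl n a i j = a i ((n ∸ j) +ℕ i)

IsHST : ℕ → Array → Set
IsHST n a = IsSteinhaus n a × (hrefl n a ≈[ n ] a)
  where open import Data.Product using (_×_)

B : ℕ → ℤ → Seq
B k l j = mod2 (binom (l + + j - + 1) k)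

ones : Seq
ones _ = true

-- ∇_k (k ≥ 1): ∇ B^{n-2k}_{n,-k} if 2k ≤ n, and ∇(1)_n otherwise
-- (for k ∈ {1..⌈n/2⌉} the second case is exactly k = (n+1)/2 with n odd)
gen : ℕ → ℕ → Array
gen n k with (2 *ℕ k) Data.Nat.≤ᵇ n
  where import Data.Nat
... | true = nabla (B (n ∸ (2 *ℕ k)) (- (+ k)))
... | false = nabla ones

zeroArr : Array
zeroArr _ _ = false

_⊕_ : Array → Array → Array
(a ⊕ b) i j = a i j xor b i j

_·_ : Bool → Array → Array
(c · a) i j = c ∧ a i j

lincomb : (m : ℕ) → (Fin m → Bool) → (Fin m → Array) → Array
lincomb zero c f = zeroArr
lincomb (suc m) c f = (c Fin.zero · f Fin.zero) ⊕ lincomb m (λ t → c (Fin.suc t)) (λ t → f (Fin.suc t))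
  where import Data.Fin as Fin

-- the family ∇_1, …, ∇_{⌈n/2⌉}, indexed by Fin ⌈n/2⌉ (t ↦ ∇_{t+1})
family : (n : ℕ) → Fin ⌈ n /2⌉ → Array
family n t = gen n (suc (toℕ t))

module Submission where

-- Every ∇_k is ∇ of an explicit first row r_k, so the theorem is
-- reduced to two facts about the first rows and to general facts about ∇:
--   * r_k is a palindrome of length n (r_k(j) = r_k(n+1-j)); for the rows
--     B^{n-2k}_{n,-k} this is the identity binom(-e-1, m) ≡ binom(e+m, m)
--     (mod 2) for binomial coefficients with negative upper index;
--   * on the first half {1, …, ⌈n/2⌉} the rows are triangular:
--     r_k(k) = 1 and r_k(j) = 0 for k < j ≤ ⌈n/2⌉ (binom(d, m) = 0 for d < m).
-- On the triangle side: ∇S is a Steinhaus triangle, it is h-invariant when S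
-- is a palindrome, ∇ is F₂-linear, and a Steinhaus triangle is ∇ of its first
-- row; hence the first row of any element of HST(n) is a palindrome.
-- A triangular family of sequences on {1, …, m} is a basis of F₂^m, and a
-- palindrome is determined by its first half; together these give linear
-- independence and spanning, and mainTheorem8 follows at the end.

open import Defs
open import Data.Nat
  using (ℕ; zero; suc; _+_; _*_; _∸_; _≤_; _<_; z≤n; s≤s; _%_; _≡ᵇ_; _≤ᵇ_; ⌈_/2⌉; ⌊_/2⌋; _≤?_)
open import Data.Nat.Properties
open import Data.Nat.Tactic.RingSolver using (solve-∀)
open import Data.Integer as ℤ using (ℤ; +_; -[1+_]; _⊖_; ∣_∣)
open import Data.Integer.Properties as ℤP using ()
open import Data.Bool using (Bool; true; false; _xor_; _∧_; not; T)
open import Data.Bool.Properties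
  using ( not-involutive; not-distribˡ-xor; xor-annihilates-not; xor-comm; xor-assoc
        ; xor-identityʳ; xor-same; ∧-identityʳ; ∧-zeroʳ; ∧-distribˡ-xor; xor-∧-commutativeRing)
open import Algebra.Bundles using (CommutativeRing)
open import Algebra.Properties.CommutativeSemigroup
  (CommutativeRing.+-commutativeSemigroup xor-∧-commutativeRing) using (interchange)
open import Data.Unit using (tt)
open import Data.Fin using (Fin; zero; suc; toℕ; inject₁; fromℕ)
open import Data.Fin.Properties using (toℕ-inject₁; toℕ-fromℕ; toℕ<n)
open import Data.Vec.Functional using (init; last)
open import Data.Sum using (_⊎_; inj₁; inj₂)
open import Data.Product using (_×_; _,_; ∃; proj₁; proj₂)
open import Function using (_∘_)
open import Relation.Nullary using (yes; no; ¬_; contradiction)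
open import Relation.Binary.PropositionalEquality

isOdd : ℕ → Bool
isOdd zero = false
isOdd (suc n) = not (isOdd n)

isOdd-%2 : ∀ n → (n % 2 ≡ᵇ 1) ≡ isOdd n
isOdd-%2 zero = refl
isOdd-%2 (suc zero) = refl
isOdd-%2 (suc (suc n)) = trans (isOdd-%2 n) (sym (not-involutive (isOdd n)))

isOdd-+ : ∀ m n → isOdd (m + n) ≡ isOdd m xor isOdd n
isOdd-+ zero n = refl
isOdd-+ (suc m) n = trans (cong not (isOdd-+ m n)) (not-distribˡ-xor (isOdd m) (isOdd n))

isOdd-⊖ : ∀ m n → isOdd ∣ m ⊖ n ∣ ≡ isOdd m xor isOdd n
isOdd-⊖ m zero = sym (xor-identityʳ (isOdd m))
isOdd-⊖ zero (suc n) = refl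
isOdd-⊖ (suc m) (suc n) = begin
  isOdd ∣ suc m ⊖ suc n ∣         ≡⟨ cong (isOdd ∘ ∣_∣) (ℤP.[1+m]⊖[1+n]≡m⊖n m n) ⟩
  isOdd ∣ m ⊖ n ∣                 ≡⟨ isOdd-⊖ m n ⟩
  isOdd m xor isOdd n             ≡⟨ xor-annihilates-not (isOdd m) (isOdd n) ⟨
  not (isOdd m) xor not (isOdd n) ∎
  where open ≡-Reasoning

isOdd-∣+∣ : ∀ x y → isOdd ∣ x ℤ.+ y ∣ ≡ isOdd ∣ x ∣ xor isOdd ∣ y ∣
isOdd-∣+∣ (+ m) (+ n) = isOdd-+ m n
isOdd-∣+∣ (+ m) -[1+ n ] = isOdd-⊖ m (suc n)
isOdd-∣+∣ -[1+ m ] (+ n) = trans (isOdd-⊖ n (suc m)) (xor-comm (isOdd n) _)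
isOdd-∣+∣ -[1+ m ] -[1+ n ] =
  trans (not-involutive _) (trans (isOdd-+ m n) (sym (xor-annihilates-not (isOdd m) (isOdd n))))

mod2-+ : ∀ x y → mod2 (x ℤ.+ y) ≡ mod2 x xor mod2 y
mod2-+ x y = begin
  mod2 (x ℤ.+ y)                   ≡⟨ isOdd-%2 ∣ x ℤ.+ y ∣ ⟩
  isOdd ∣ x ℤ.+ y ∣                ≡⟨ isOdd-∣+∣ x y ⟩
  isOdd ∣ x ∣ xor isOdd ∣ y ∣      ≡⟨ cong₂ _xor_ (isOdd-%2 ∣ x ∣) (isOdd-%2 ∣ y ∣) ⟨
  mod2 x xor mod2 y                ∎
  where open ≡-Reasoning

mod2-- : ∀ x y → mod2 (x ℤ.- y) ≡ mod2 x xor mod2 y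
mod2-- x y = trans (mod2-+ x (ℤ.- y)) (cong (λ n → mod2 x xor ((n % 2) ≡ᵇ 1)) (ℤP.∣-i∣≡∣i∣ y))

binom₂ : ℕ → ℕ → Bool
binom₂ a zero = true
binom₂ zero (suc b) = false
binom₂ (suc a) (suc b) = binom₂ a b xor binom₂ a (suc b)

binom₂-above : ∀ a b → a < b → binom₂ a b ≡ false
binom₂-above zero (suc b) _ = refl
binom₂-above (suc a) (suc b) (s≤s a<b)
  rewrite binom₂-above a b a<b | binom₂-above a (suc b) (m<n⇒m<1+n a<b) = refl

binom₂-diagonal : ∀ b → binom₂ b b ≡ true
binom₂-diagonal zero = refl
binom₂-diagonal (suc b) rewrite binom₂-diagonal b | binom₂-above b (suc b) (n<1+n b) = refl

mod2-posBinom : ∀ a b → mod2 (posBinom a b) ≡ binom₂ a b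
mod2-posBinom a zero = refl
mod2-posBinom zero (suc b) = refl
mod2-posBinom (suc a) (suc b) =
  trans (mod2-+ (posBinom a b) (posBinom a (suc b)))
        (cong₂ _xor_ (mod2-posBinom a b) (mod2-posBinom a (suc b)))

-- binom(-(e+1), b) = (-1)^b · binom(e+b, b), hence the two agree mod 2.
mod2-negBinom : ∀ e b → mod2 (negBinom (suc e) b) ≡ binom₂ (e + b) b
mod2-negBinom e zero = refl
mod2-negBinom zero (suc b) = begin
  mod2 (+ 0 ℤ.- negBinom 1 b)  ≡⟨ mod2-- (+ 0) (negBinom 1 b) ⟩
  mod2 (negBinom 1 b)          ≡⟨ mod2-negBinom zero b ⟩
  binom₂ b b                   ≡⟨ xor-identityʳ (binom₂ b b) ⟨
  binom₂ b b xor false         ≡⟨ cong (binom₂ b b xor_) (binom₂-above b (suc b) (n<1+n b)) ⟨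
  binom₂ b b xor binom₂ b (suc b) ∎
  where open ≡-Reasoning
mod2-negBinom (suc e) (suc b) = begin
  mod2 (negBinom (suc e) (suc b) ℤ.- negBinom (suc (suc e)) b)
    ≡⟨ mod2-- (negBinom (suc e) (suc b)) (negBinom (suc (suc e)) b) ⟩
  mod2 (negBinom (suc e) (suc b)) xor mod2 (negBinom (suc (suc e)) b)
    ≡⟨ cong₂ _xor_ (mod2-negBinom e (suc b)) (mod2-negBinom (suc e) b) ⟩
  binom₂ (e + suc b) (suc b) xor binom₂ (suc e + b) b
    ≡⟨ cong (λ a → binom₂ (e + suc b) (suc b) xor binom₂ a b) (+-suc e b) ⟨
  binom₂ (e + suc b) (suc b) xor binom₂ (e + suc b) b
    ≡⟨ xor-comm (binom₂ (e + suc b) (suc b)) _ ⟩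
  binom₂ (e + suc b) b xor binom₂ (e + suc b) (suc b) ∎
  where open ≡-Reasoning

B-entry : ∀ m k j → B m (ℤ.- (+ k)) j ≡ mod2 (binom (j ⊖ suc k) m)
B-entry m k j = cong (λ x → mod2 (binom x m)) (begin
  ℤ.- (+ k) ℤ.+ + j ℤ.- + 1 ≡⟨ cong (ℤ._- + 1) (ℤP.-m+n≡n⊖m k j) ⟩
  j ⊖ k ℤ.+ -[1+ 0 ]         ≡⟨ ℤP.distribˡ-⊖-+-neg 0 j k ⟩
  j ⊖ (suc k + 0)            ≡⟨ cong (j ⊖_) (+-identityʳ (suc k)) ⟩
  j ⊖ suc k                  ∎)
  where open ≡-Reasoning

B-right : ∀ m k d → B m (ℤ.- (+ k)) (suc k + d) ≡ binom₂ d m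
B-right m k d = begin
  B m (ℤ.- (+ k)) (suc k + d)            ≡⟨ B-entry m k (suc k + d) ⟩
  mod2 (binom ((suc k + d) ⊖ suc k) m)   ≡⟨ cong (λ x → mod2 (binom x m)) shift ⟩
  mod2 (posBinom d m)                    ≡⟨ mod2-posBinom d m ⟩
  binom₂ d m                             ∎
  where
    open ≡-Reasoning
    shift : (suc k + d) ⊖ suc k ≡ + d
    shift = trans (ℤP.⊖-≥ (m≤m+n (suc k) d)) (cong +_ (m+n∸m≡n (suc k) d))

B-left : ∀ m j e → B m (ℤ.- (+ (j + e))) j ≡ binom₂ (e + m) m
B-left m j e = begin
  B m (ℤ.- (+ (j + e))) j                 ≡⟨ B-entry m (j + e) j ⟩
  mod2 (binom (j ⊖ suc (j + e)) m)        ≡⟨ cong (λ x → mod2 (binom x m)) shift ⟩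
  mod2 (negBinom (suc e) m)               ≡⟨ mod2-negBinom e m ⟩
  binom₂ (e + m) m                        ∎
  where
    open ≡-Reasoning
    shift : j ⊖ suc (j + e) ≡ -[1+ e ]
    shift = begin
      j ⊖ suc (j + e)        ≡⟨ cong (j ⊖_) (+-suc j e) ⟨
      j ⊖ (j + suc e)        ≡⟨ ℤP.⊖-≤ (m≤m+n j (suc e)) ⟩
      ℤ.- + (j + suc e ∸ j)  ≡⟨ cong (λ x → ℤ.- + x) (m+n∸m≡n j (suc e)) ⟩
      -[1+ e ]               ∎

Palindromic : ℕ → Seq → Set
Palindromic n S = ∀ j j' → 1 ≤ j → 1 ≤ j' → j + j' ≡ suc n → S j ≡ S j'

-- Mirrored around position k of B^m_{·,-k} (length 2k + m), a position j ≤ k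
-- and its mirror image carry binom(-(e+1), m) ≡ binom(e+m, m), where k = j + e.
B-mirror-left : ∀ k m j j' → j ≤ k → j + j' ≡ suc (2 * k + m) →
                B m (ℤ.- (+ k)) j ≡ B m (ℤ.- (+ k)) j'
B-mirror-left k m j j' j≤k j+j' with m≤n⇒∃[o]m+o≡n j≤k
... | e , refl = begin
  B m (ℤ.- (+ (j + e))) j                            ≡⟨ B-left m j e ⟩
  binom₂ (e + m) m                                   ≡⟨ B-right m (j + e) (e + m) ⟨
  B m (ℤ.- (+ (j + e))) (suc (j + e) + (e + m))      ≡⟨ cong (B m (ℤ.- (+ (j + e)))) j'≡ ⟨
  B m (ℤ.- (+ (j + e))) j'                           ∎
  where
    open ≡-Reasoning
    arith : ∀ j e m → suc (2 * (j + e) + m) ≡ j + (suc (j + e) + (e + m))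
    arith = solve-∀
    j'≡ : j' ≡ suc (j + e) + (e + m)
    j'≡ = +-cancelˡ-≡ j j' _ (trans j+j' (arith j e m))

-- Two mirrored positions both right of k carry binom(d, m), binom(d', m) with
-- d + d' + 1 = m, so both vanish.
B-mirror-right : ∀ k m j j' → k < j → k < j' → j + j' ≡ suc (2 * k + m) →
                 B m (ℤ.- (+ k)) j ≡ B m (ℤ.- (+ k)) j'
B-mirror-right k m j j' k<j k<j' j+j' with m≤n⇒∃[o]m+o≡n k<j | m≤n⇒∃[o]m+o≡n k<j'
... | d , refl | d' , refl = begin
  B m (ℤ.- (+ k)) (suc k + d)    ≡⟨ B-right m k d ⟩
  binom₂ d m                     ≡⟨ binom₂-above d m d<m ⟩
  false                          ≡⟨ binom₂-above d' m d'<m ⟨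
  binom₂ d' m                    ≡⟨ B-right m k d' ⟨
  B m (ℤ.- (+ k)) (suc k + d')   ∎
  where
    open ≡-Reasoning
    arith : ∀ k d d' → suc k + d + (suc k + d') ≡ suc (2 * k + suc (d + d'))
    arith = solve-∀
    m≡ : suc (d + d') ≡ m
    m≡ = +-cancelˡ-≡ (2 * k) _ _ (suc-injective (trans (sym (arith k d d')) j+j'))
    d<m : d < m
    d<m = subst (d <_) m≡ (s≤s (m≤m+n d d'))
    d'<m : d' < m
    d'<m = subst (d' <_) m≡ (s≤s (m≤n+m d' d))

B-palindromic : ∀ k m → Palindromic (2 * k + m) (B m (ℤ.- (+ k)))
B-palindromic k m j j' _ _ j+j' with j ≤? k | j' ≤? k
... | yes j≤k | _ = B-mirror-left k m j j' j≤k j+j'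
... | no _ | yes j'≤k = sym (B-mirror-left k m j' j j'≤k (trans (+-comm j' j) j+j'))
... | no j≰k | no j'≰k = B-mirror-right k m j j' (≰⇒> j≰k) (≰⇒> j'≰k) j+j'

firstRow : ℕ → ℕ → Seq
firstRow n k with (2 * k) ≤ᵇ n
... | true = B (n ∸ (2 * k)) (ℤ.- (+ k))
... | false = ones

gen-nabla : ∀ n k i j → gen n k i j ≡ nabla (firstRow n k) i j
gen-nabla n k i j with (2 * k) ≤ᵇ n
... | true = refl
... | false = refl

firstRow-B : ∀ n k → 2 * k ≤ n → ∀ j → firstRow n k j ≡ B (n ∸ (2 * k)) (ℤ.- (+ k)) j
firstRow-B n k 2k≤n j with (2 * k) ≤ᵇ n | ≤⇒≤ᵇ 2k≤n
... | true | _ = refl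

firstRow-ones : ∀ n k → ¬ (2 * k ≤ n) → ∀ j → firstRow n k j ≡ true
firstRow-ones n k 2k≰n j with (2 * k) ≤ᵇ n in eq
... | true = contradiction (≤ᵇ⇒≤ (2 * k) n (subst T (sym eq) tt)) 2k≰n
... | false = refl

palindromic-cong : ∀ n S S' → (∀ j → S j ≡ S' j) → Palindromic n S → Palindromic n S'
palindromic-cong n S S' S≗S' P j j' 1≤j 1≤j' j+j' = trans (sym (S≗S' j)) (trans (P j j' 1≤j 1≤j' j+j') (S≗S' j'))

firstRow-palindromic : ∀ n k → Palindromic n (firstRow n k)
firstRow-palindromic n k with 2 * k ≤? n
... | yes 2k≤n = palindromic-cong n _ _ (sym ∘ firstRow-B n k 2k≤n)
                   (subst (λ n' → Palindromic n' (B (n ∸ (2 * k)) (ℤ.- (+ k))))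
                          (m+[n∸m]≡n 2k≤n) (B-palindromic k (n ∸ (2 * k))))
... | no 2k≰n = palindromic-cong n ones _ (sym ∘ firstRow-ones n k 2k≰n) (λ _ _ _ _ _ → refl)

firstRow-diagonal : ∀ n k → 1 ≤ k → firstRow n k k ≡ true
firstRow-diagonal n k@(suc _) _ with 2 * k ≤? n
... | yes 2k≤n = begin
  firstRow n k k                           ≡⟨ firstRow-B n k 2k≤n k ⟩
  B m (ℤ.- (+ k)) k                        ≡⟨ cong (λ k' → B m (ℤ.- (+ k')) k) (+-identityʳ k) ⟨
  B m (ℤ.- (+ (k + 0))) k                  ≡⟨ B-left m k 0 ⟩
  binom₂ m m                               ≡⟨ binom₂-diagonal m ⟩
  true                                     ∎
  where
    open ≡-Reasoning
    m : ℕ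
    m = n ∸ (2 * k)
... | no 2k≰n = firstRow-ones n k 2k≰n k

2*-≡-+ : ∀ k → 2 * k ≡ k + k
2*-≡-+ k = cong (λ x → k + x) (+-identityʳ k)

ceil-half-≤ : ∀ n k → ¬ (2 * k ≤ n) → ⌈ n /2⌉ ≤ k
ceil-half-≤ n k 2k≰n =
  subst (⌈ n /2⌉ ≤_) (sym (n≡⌊n+n/2⌋ k)) (⌊n/2⌋-mono (subst (suc n ≤_) (2*-≡-+ k) (≰⇒> 2k≰n)))

-- If 2k ≤ n then k ≤ ⌊n/2⌋, so any j ≤ ⌈n/2⌉ satisfies j + k ≤ n.
first-half-+-≤ : ∀ n k j → 2 * k ≤ n → j ≤ ⌈ n /2⌉ → j + k ≤ n
first-half-+-≤ n k j 2k≤n j≤h = begin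
  j + k                  ≤⟨ +-mono-≤ j≤h k≤⌊n/2⌋ ⟩
  ⌈ n /2⌉ + ⌊ n /2⌋      ≡⟨ +-comm ⌈ n /2⌉ ⌊ n /2⌋ ⟩
  ⌊ n /2⌋ + ⌈ n /2⌉      ≡⟨ ⌊n/2⌋+⌈n/2⌉≡n n ⟩
  n                      ∎
  where
    open ≤-Reasoning
    k≤⌊n/2⌋ : k ≤ ⌊ n /2⌋
    k≤⌊n/2⌋ = subst (_≤ ⌊ n /2⌋) (sym (n≡⌊n+n/2⌋ k)) (⌊n/2⌋-mono (subst (_≤ n) (2*-≡-+ k) 2k≤n))

-- Triangularity on the first half, zero part: r_k(j) = 0 for k < j ≤ ⌈n/2⌉,
-- since r_k(k+1+d) = binom(d, n-2k) and d < n-2k there.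
firstRow-above : ∀ n k j → k < j → j ≤ ⌈ n /2⌉ → firstRow n k j ≡ false
firstRow-above n k j k<j j≤h with 2 * k ≤? n
... | no 2k≰n = contradiction (≤-trans j≤h (ceil-half-≤ n k 2k≰n)) (<⇒≱ k<j)
... | yes 2k≤n with m≤n⇒∃[o]m+o≡n k<j
...   | d , refl = begin
  firstRow n k (suc k + d)                 ≡⟨ firstRow-B n k 2k≤n (suc k + d) ⟩
  B (n ∸ (2 * k)) (ℤ.- (+ k)) (suc k + d)  ≡⟨ B-right (n ∸ (2 * k)) k d ⟩
  binom₂ d (n ∸ (2 * k))                   ≡⟨ binom₂-above d (n ∸ (2 * k)) d<n-2k ⟩
  false                                    ∎
  where
    open ≡-Reasoning
    arith : ∀ k d → suc k + d + k ≡ suc d + 2 * k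
    arith = solve-∀
    d<n-2k : d < n ∸ (2 * k)
    d<n-2k = m+n≤o⇒m≤o∸n (suc d) (subst (_≤ n) (arith k d) (first-half-+-≤ n k (suc k + d) 2k≤n j≤h))

nabla-steinhaus : ∀ S n → IsSteinhaus n (nabla S)
nabla-steinhaus S n (suc (suc i)) j _ _ _ = refl
nabla-steinhaus S n (suc zero) j (s≤s ()) _ _

nabla-row-mirror : ∀ n S → Palindromic n S → ∀ i → 1 ≤ i → ∀ j j' → i ≤ j → i ≤ j' →
                   j + j' ≡ n + i → nabla S i j ≡ nabla S i j'
nabla-row-mirror n S P (suc zero) _ j j' 1≤j 1≤j' j+j' = P j j' 1≤j 1≤j' (trans j+j' (+-comm n 1))
nabla-row-mirror n S P (suc (suc i)) _ (suc j) (suc j') (s≤s i<j) (s≤s i<j') j+j' =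
  trans (cong₂ _xor_ (mirror j (suc j') i<j (m≤n⇒m≤1+n i<j') j+1+j')
                     (mirror (suc j) j' (m≤n⇒m≤1+n i<j) i<j' (trans (sym (+-suc j j')) j+1+j')))
        (xor-comm (nabla S (suc i) (suc j')) (nabla S (suc i) j'))
  where
    mirror : ∀ j j' → suc i ≤ j → suc i ≤ j' → j + j' ≡ n + suc i → nabla S (suc i) j ≡ nabla S (suc i) j'
    mirror = nabla-row-mirror n S P (suc i) (s≤s z≤n)
    j+1+j' : j + suc j' ≡ n + suc i
    j+1+j' = suc-injective (trans j+j' (+-suc n (suc i)))

nabla-symmetric : ∀ n S → Palindromic n S → hrefl n (nabla S) ≈[ n ] nabla S
nabla-symmetric n S P i j 1≤i i≤j j≤n =
  nabla-row-mirror n S P i 1≤i (n ∸ j + i) j (m≤n+m i (n ∸ j)) i≤j (begin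
    n ∸ j + i + j    ≡⟨ +-comm (n ∸ j + i) j ⟩
    j + (n ∸ j + i)  ≡⟨ +-assoc j (n ∸ j) i ⟨
    j + (n ∸ j) + i  ≡⟨ cong (_+ i) (m+[n∸m]≡n j≤n) ⟩
    n + i            ∎)
  where open ≡-Reasoning

nabla-hst : ∀ n S → Palindromic n S → IsHST n (nabla S)
nabla-hst n S P = nabla-steinhaus S n , nabla-symmetric n S P

hst-cong : ∀ n a b → (∀ i j → a i j ≡ b i j) → IsHST n a → IsHST n b
hst-cong n a b a≗b (st , sym-a) =
  (λ i j 2≤i i≤j j≤n → trans (sym (a≗b i j))
     (trans (st i j 2≤i i≤j j≤n) (cong₂ _xor_ (a≗b (i ∸ 1) (j ∸ 1)) (a≗b (i ∸ 1) j)))) ,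
  (λ i j 1≤i i≤j j≤n → trans (sym (a≗b i (n ∸ j + i))) (trans (sym-a i j 1≤i i≤j j≤n) (a≗b i j)))

nabla-linear : ∀ b S S' i j →
               nabla (λ x → (b ∧ S x) xor S' x) i j ≡ (b ∧ nabla S i j) xor nabla S' i j
nabla-linear b S S' zero j = refl
nabla-linear b S S' (suc zero) j = refl
nabla-linear b S S' (suc (suc i)) j = begin
  nabla (λ x → (b ∧ S x) xor S' x) (suc (suc i)) j
    ≡⟨ cong₂ _xor_ (nabla-linear b S S' (suc i) (j ∸ 1)) (nabla-linear b S S' (suc i) j) ⟩
  ((b ∧ u) xor u') xor ((b ∧ v) xor v')    ≡⟨ interchange (b ∧ u) u' (b ∧ v) v' ⟩
  ((b ∧ u) xor (b ∧ v)) xor (u' xor v')    ≡⟨ cong (_xor (u' xor v')) (∧-distribˡ-xor b u v) ⟨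
  (b ∧ (u xor v)) xor (u' xor v')          ∎
  where
    open ≡-Reasoning
    u v u' v' : Bool
    u = nabla S (suc i) (j ∸ 1)
    v = nabla S (suc i) j
    u' = nabla S' (suc i) (j ∸ 1)
    v' = nabla S' (suc i) j

nabla-zero : ∀ i j → nabla (λ _ → false) i j ≡ false
nabla-zero zero j = refl
nabla-zero (suc zero) j = refl
nabla-zero (suc (suc i)) j = cong₂ _xor_ (nabla-zero (suc i) (j ∸ 1)) (nabla-zero (suc i) j)

nabla-cong : ∀ n S S' → (∀ j → 1 ≤ j → j ≤ n → S j ≡ S' j) → nabla S ≈[ n ] nabla S'
nabla-cong n S S' S≗S' (suc zero) j _ 1≤j j≤n = S≗S' j 1≤j j≤n
nabla-cong n S S' S≗S' (suc (suc i)) (suc j) _ (s≤s i<j) j<n =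
  cong₂ _xor_ (nabla-cong n S S' S≗S' (suc i) j (s≤s z≤n) i<j (≤-trans (n≤1+n j) j<n))
              (nabla-cong n S S' S≗S' (suc i) (suc j) (s≤s z≤n) (m≤n⇒m≤1+n i<j) j<n)

steinhaus-nabla : ∀ n a → IsSteinhaus n a → a ≈[ n ] nabla (a 1)
steinhaus-nabla n a st (suc zero) j _ _ _ = refl
steinhaus-nabla n a st (suc (suc i)) (suc j) _ (s≤s i<j) j<n =
  trans (st (suc (suc i)) (suc j) (s≤s (s≤s z≤n)) (s≤s i<j) j<n)
        (cong₂ _xor_ (steinhaus-nabla n a st (suc i) j (s≤s z≤n) i<j (≤-trans (n≤1+n j) j<n))
                     (steinhaus-nabla n a st (suc i) (suc j) (s≤s z≤n) (m≤n⇒m≤1+n i<j) j<n))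

symmetric-firstRow-palindromic : ∀ n a → hrefl n a ≈[ n ] a → Palindromic n (a 1)
symmetric-firstRow-palindromic n a sym-a j (suc j'') 1≤j _ j+j' =
  sym (trans (cong (a 1) j'≡) (sym-a 1 j (s≤s z≤n) 1≤j j≤n))
  where
    j+j''≡n : j + j'' ≡ n
    j+j''≡n = suc-injective (trans (sym (+-suc j j'')) j+j')
    j≤n : j ≤ n
    j≤n = subst (j ≤_) j+j''≡n (m≤m+n j j'')
    j'≡ : suc j'' ≡ n ∸ j + 1
    j'≡ = trans (cong suc (sym (trans (cong (_∸ j) (sym j+j''≡n)) (m+n∸m≡n j j''))))
                (+-comm 1 (n ∸ j))

combine : (m : ℕ) → (Fin m → Bool) → (Fin m → Seq) → Seq
combine zero c f j = false
combine (suc m) c f j = (c zero ∧ f zero j) xor combine m (c ∘ suc) (f ∘ suc) j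

lincomb-nabla : ∀ m c (F : Fin m → Array) g → (∀ t i j → F t i j ≡ nabla (g t) i j) →
                ∀ i j → lincomb m c F i j ≡ nabla (combine m c g) i j
lincomb-nabla zero c F g F≗ i j = sym (nabla-zero i j)
lincomb-nabla (suc m) c F g F≗ i j =
  trans (cong₂ _xor_ (cong (c zero ∧_) (F≗ zero i j))
                     (lincomb-nabla m (c ∘ suc) (F ∘ suc) (g ∘ suc) (F≗ ∘ suc) i j))
        (sym (nabla-linear (c zero) (g zero) (combine m (c ∘ suc) (g ∘ suc)) i j))

combine-snoc : ∀ m c f j → combine (suc m) c f j ≡ combine m (init c) (init f) j xor (last c ∧ last f j)
combine-snoc zero c f j = xor-identityʳ _
combine-snoc (suc m) c f j =
  trans (cong ((c zero ∧ f zero j) xor_) (combine-snoc m (c ∘ suc) (f ∘ suc) j))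
        (sym (xor-assoc (c zero ∧ f zero j) _ _))

combine-coeff-cong : ∀ m c c' f j → (∀ t → c t ≡ c' t) → combine m c f j ≡ combine m c' f j
combine-coeff-cong zero c c' f j c≗c' = refl
combine-coeff-cong (suc m) c c' f j c≗c' =
  cong₂ _xor_ (cong (_∧ f zero j) (c≗c' zero)) (combine-coeff-cong m (c ∘ suc) (c' ∘ suc) (f ∘ suc) j (c≗c' ∘ suc))

combine-vanishing : ∀ m c f j → (∀ t → f t j ≡ false) → combine m c f j ≡ false
combine-vanishing zero c f j f≡0 = refl
combine-vanishing (suc m) c f j f≡0 =
  cong₂ _xor_ (trans (cong (c zero ∧_) (f≡0 zero)) (∧-zeroʳ (c zero)))
              (combine-vanishing m (c ∘ suc) (f ∘ suc) j (f≡0 ∘ suc))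

combine-palindromic : ∀ n m c f → (∀ t → Palindromic n (f t)) → Palindromic n (combine m c f)
combine-palindromic n zero c f P j j' 1≤j 1≤j' j+j' = refl
combine-palindromic n (suc m) c f P j j' 1≤j 1≤j' j+j' =
  cong₂ _xor_ (cong (c zero ∧_) (P zero j j' 1≤j 1≤j' j+j'))
              (combine-palindromic n m (c ∘ suc) (f ∘ suc) (P ∘ suc) j j' 1≤j 1≤j' j+j')

inject₁-or-last : ∀ {m} (t : Fin (suc m)) → (∃ λ t' → t ≡ inject₁ t') ⊎ t ≡ fromℕ m
inject₁-or-last {zero} zero = inj₂ refl
inject₁-or-last {suc m} zero = inj₁ (zero , refl)
inject₁-or-last {suc m} (suc t) with inject₁-or-last t
... | inj₁ (t' , t≡) = inj₁ (suc t' , cong suc t≡)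
... | inj₂ t≡ = inj₂ (cong suc t≡)

_∷ʳ_ : ∀ {A : Set} {m} → (Fin m → A) → A → Fin (suc m) → A
_∷ʳ_ {m = zero} c b _ = b
_∷ʳ_ {m = suc m} c b zero = c zero
_∷ʳ_ {m = suc m} c b (suc t) = ((c ∘ suc) ∷ʳ b) t

init-∷ʳ : ∀ {A : Set} {m} (c : Fin m → A) b (t : Fin m) → init (c ∷ʳ b) t ≡ c t
init-∷ʳ {m = suc m} c b zero = refl
init-∷ʳ {m = suc m} c b (suc t) = init-∷ʳ (c ∘ suc) b t

last-∷ʳ : ∀ {A : Set} m (c : Fin m → A) b → last (c ∷ʳ b) ≡ b
last-∷ʳ zero c b = refl
last-∷ʳ (suc m) c b = last-∷ʳ m (c ∘ suc) b

Triangular : (m : ℕ) → (Fin m → Seq) → Set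
Triangular m f = (∀ t → f t (suc (toℕ t)) ≡ true)
               × (∀ t j → suc (toℕ t) < j → j ≤ m → f t j ≡ false)

triangular-init : ∀ m f → Triangular (suc m) f → Triangular m (init f)
triangular-init m f (diag , above) =
  (λ t → subst (λ x → f (inject₁ t) (suc x) ≡ true) (toℕ-inject₁ t) (diag (inject₁ t))) ,
  (λ t j t<j j≤m → above (inject₁ t) j (subst (λ x → suc x < j) (sym (toℕ-inject₁ t)) t<j) (m≤n⇒m≤1+n j≤m))

-- At the top position m+1 only the last member is non-zero, so the top entry
-- of a combination is its last coefficient.
combine-top : ∀ m c f → Triangular (suc m) f → combine (suc m) c f (suc m) ≡ last c
combine-top m c f (diag , above) = begin
  combine (suc m) c f (suc m)                                       ≡⟨ combine-snoc m c f (suc m) ⟩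
  combine m (init c) (init f) (suc m) xor (last c ∧ last f (suc m)) ≡⟨ cong₂ (λ x y → x xor (last c ∧ y)) inits-vanish last-one ⟩
  false xor (last c ∧ true)                                         ≡⟨ ∧-identityʳ (last c) ⟩
  last c                                                            ∎
  where
    open ≡-Reasoning
    inits-vanish : combine m (init c) (init f) (suc m) ≡ false
    inits-vanish = combine-vanishing m (init c) (init f) (suc m) (λ t →
      above (inject₁ t) (suc m) (subst (λ x → suc x < suc m) (sym (toℕ-inject₁ t)) (s≤s (toℕ<n t))) ≤-refl)
    last-one : last f (suc m) ≡ true
    last-one = subst (λ x → f (fromℕ m) (suc x) ≡ true) (toℕ-fromℕ m) (diag (fromℕ m))

triangular-independent : ∀ m c f → Triangular m f →
                         (∀ j → 1 ≤ j → j ≤ m → combine m c f j ≡ false) → ∀ t → c t ≡ false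
triangular-independent (suc m) c f tri c·f≡0 t = by-position (inject₁-or-last t)
  where
    open ≡-Reasoning
    last≡0 : last c ≡ false
    last≡0 = trans (sym (combine-top m c f tri)) (c·f≡0 (suc m) (s≤s z≤n) ≤-refl)
    init≡0 : ∀ j → 1 ≤ j → j ≤ m → combine m (init c) (init f) j ≡ false
    init≡0 j 1≤j j≤m = begin
      combine m (init c) (init f) j                             ≡⟨ xor-identityʳ _ ⟨
      combine m (init c) (init f) j xor (false ∧ last f j)      ≡⟨ cong (λ x → combine m (init c) (init f) j xor (x ∧ last f j)) last≡0 ⟨
      combine m (init c) (init f) j xor (last c ∧ last f j)     ≡⟨ combine-snoc m c f j ⟨
      combine (suc m) c f j                                     ≡⟨ c·f≡0 j 1≤j (m≤n⇒m≤1+n j≤m) ⟩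
      false                                                     ∎
    by-position : (∃ λ t' → t ≡ inject₁ t') ⊎ t ≡ fromℕ m → c t ≡ false
    by-position (inj₁ (t' , t≡)) = subst (λ x → c x ≡ false) (sym t≡)
      (triangular-independent m (init c) (init f) (triangular-init m f tri) init≡0 t')
    by-position (inj₂ t≡) = subst (λ x → c x ≡ false) (sym t≡) last≡0

-- A triangular family spans all sequences on positions 1, …, m: solve for the
-- last coefficient at the top position, then recurse on the remainder.
triangular-spanning : ∀ m f (S : Seq) → Triangular m f →
                      ∃ λ (c : Fin m → Bool) → ∀ j → 1 ≤ j → j ≤ m → combine m c f j ≡ S j
triangular-spanning zero f S tri = (λ ()) , λ j 1≤j j≤0 → contradiction (≤-trans 1≤j j≤0) λ ()
triangular-spanning (suc m) f S tri = c , solves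
  where
    b : Bool
    b = S (suc m)
    remainder : Seq
    remainder j = S j xor (b ∧ last f j)
    init-solution : ∃ λ (c' : Fin m → Bool) → ∀ j → 1 ≤ j → j ≤ m → combine m c' (init f) j ≡ remainder j
    init-solution = triangular-spanning m (init f) remainder (triangular-init m f tri)
    c : Fin (suc m) → Bool
    c = proj₁ init-solution ∷ʳ b
    solves : ∀ j → 1 ≤ j → j ≤ suc m → combine (suc m) c f j ≡ S j
    solves j 1≤j j≤1+m with j ≤? m
    ... | yes j≤m = begin
      combine (suc m) c f j                                    ≡⟨ combine-snoc m c f j ⟩
      combine m (init c) (init f) j xor (last c ∧ last f j)
        ≡⟨ cong₂ (λ x y → x xor (y ∧ last f j))
                 (combine-coeff-cong m (init c) _ (init f) j (init-∷ʳ (proj₁ init-solution) b))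
                 (last-∷ʳ m (proj₁ init-solution) b) ⟩
      combine m (proj₁ init-solution) (init f) j xor (b ∧ last f j)
        ≡⟨ cong (_xor (b ∧ last f j)) (proj₂ init-solution j 1≤j j≤m) ⟩
      (S j xor (b ∧ last f j)) xor (b ∧ last f j)              ≡⟨ xor-assoc (S j) _ _ ⟩
      S j xor ((b ∧ last f j) xor (b ∧ last f j))              ≡⟨ cong (S j xor_) (xor-same (b ∧ last f j)) ⟩
      S j xor false                                            ≡⟨ xor-identityʳ (S j) ⟩
      S j                                                      ∎
      where open ≡-Reasoning
    ... | no j≰m with ≤-antisym j≤1+m (≰⇒> j≰m)
    ...   | refl = trans (combine-top m c f tri) (last-∷ʳ m (proj₁ init-solution) b)

mirror-in-first-half : ∀ n j → j ≤ n → ¬ (j ≤ ⌈ n /2⌉) → suc (n ∸ j) ≤ ⌈ n /2⌉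
mirror-in-first-half n j j≤n j≰h = +-cancelʳ-< j (n ∸ j) h (begin-strict
  n ∸ j + j        ≡⟨ m∸n+n≡m j≤n ⟩
  n                ≡⟨ ⌊n/2⌋+⌈n/2⌉≡n n ⟨
  ⌊ n /2⌋ + h      ≤⟨ +-monoˡ-≤ h (⌊n/2⌋≤⌈n/2⌉ n) ⟩
  h + h            <⟨ +-monoʳ-< h (≰⇒> j≰h) ⟩
  h + j            ∎)
  where
    open ≤-Reasoning
    h : ℕ
    h = ⌈ n /2⌉

palindrome-extension : ∀ n S S' → Palindromic n S → Palindromic n S' →
                       (∀ j → 1 ≤ j → j ≤ ⌈ n /2⌉ → S j ≡ S' j) → ∀ j → 1 ≤ j → j ≤ n → S j ≡ S' j
palindrome-extension n S S' P P' S≗S' j 1≤j j≤n with j ≤? ⌈ n /2⌉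
... | yes j≤h = S≗S' j 1≤j j≤h
... | no j≰h = begin
  S j     ≡⟨ P j j' 1≤j (s≤s z≤n) j+j' ⟩
  S j'    ≡⟨ S≗S' j' (s≤s z≤n) (mirror-in-first-half n j j≤n j≰h) ⟩
  S' j'   ≡⟨ P' j j' 1≤j (s≤s z≤n) j+j' ⟨
  S' j    ∎
  where
    open ≡-Reasoning
    j' : ℕ
    j' = suc (n ∸ j)
    j+j' : j + j' ≡ suc n
    j+j' = trans (+-suc j (n ∸ j)) (cong suc (m+[n∸m]≡n j≤n))

firstRows : (n : ℕ) → Fin ⌈ n /2⌉ → Seq
firstRows n t = firstRow n (suc (toℕ t))

firstRows-triangular : ∀ n → Triangular ⌈ n /2⌉ (firstRows n)
firstRows-triangular n =
  (λ t → firstRow-diagonal n (suc (toℕ t)) (s≤s z≤n)) ,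
  (λ t j t<j j≤h → firstRow-above n (suc (toℕ t)) j t<j j≤h)

family-nabla : ∀ n t i j → family n t i j ≡ nabla (firstRows n t) i j
family-nabla n t = gen-nabla n (suc (toℕ t))

firstRows-palindromic : ∀ n t → Palindromic n (firstRows n t)
firstRows-palindromic n t = firstRow-palindromic n (suc (toℕ t))

family-lincomb : ∀ n c i j →
                 lincomb ⌈ n /2⌉ c (family n) i j ≡ nabla (combine ⌈ n /2⌉ c (firstRows n)) i j
family-lincomb n c = lincomb-nabla ⌈ n /2⌉ c (family n) (firstRows n) (family-nabla n)

mainTheorem8 : (n : ℕ) →
    ((t : Fin ⌈ n /2⌉) → IsHST n (family n t))
    × ((c : Fin ⌈ n /2⌉ → Bool) → lincomb ⌈ n /2⌉ c (family n) ≈[ n ] zeroArr → (t : Fin ⌈ n /2⌉) → c t ≡ false)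
    × ((a : Array) → IsHST n a → ∃ λ (c : Fin ⌈ n /2⌉ → Bool) → a ≈[ n ] lincomb ⌈ n /2⌉ c (family n))
mainTheorem8 n = members , independent , spanning
  where
    h : ℕ
    h = ⌈ n /2⌉

    members : (t : Fin h) → IsHST n (family n t)
    members t = hst-cong n _ _ (λ i j → sym (family-nabla n t i j)) (nabla-hst n _ (firstRows-palindromic n t))

    -- a vanishing combination has vanishing first row, in particular on the first half
    independent : (c : Fin h → Bool) → lincomb h c (family n) ≈[ n ] zeroArr → (t : Fin h) → c t ≡ false
    independent c c·∇≡0 = triangular-independent h c (firstRows n) (firstRows-triangular n)
      (λ j 1≤j j≤h → trans (sym (family-lincomb n c 1 j)) (c·∇≡0 1 j ≤-refl 1≤j (≤-trans j≤h (⌈n/2⌉≤n n))))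

    -- solve for the first half of the first row; palindromy extends this to the
    -- whole first row, and the first row determines the triangle
    spanning : (a : Array) → IsHST n a → ∃ λ (c : Fin h → Bool) → a ≈[ n ] lincomb h c (family n)
    spanning a (st , sym-a) with triangular-spanning h (firstRows n) (a 1) (firstRows-triangular n)
    ... | c , c·r≡a₁ = c , λ i j 1≤i i≤j j≤n → trans (steinhaus-nabla n a st i j 1≤i i≤j j≤n)
      (trans (nabla-cong n (a 1) (combine h c (firstRows n)) same-first-row i j 1≤i i≤j j≤n)
             (sym (family-lincomb n c i j)))
      where
        same-first-row : ∀ j → 1 ≤ j → j ≤ n → a 1 j ≡ combine h c (firstRows n) j
        same-first-row = palindrome-extension n _ _ (symmetric-firstRow-palindromic n a sym-a)
          (combine-palindromic n h c (firstRows n) (firstRows-palindromic n)) (λ j 1≤j j≤h → sym (c·r≡a₁ j 1≤j j≤h))
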